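{- Let $K$ be a local field and let $L/K$ be a totally ramified separable extension of degree $p^n$, with lower ramification numbers $b_1\le\dots\le b_n$ and upper ramification numbers $u_1\le\dots\le u_n$. Then (a) $b_j-b_i\le p^{j-1}(u_j-u_i)$ for $1\le i\le j\le n$; (b) $b_j\le p^{j-1}u_j$ for $1\le j\le n$, with equality only if $j=1$.
   Context: A local field is a field complete with respect to a discrete valuation with perfect residue field of characteristic $p$. Let $\Gamma$ be the set of $K$-embeddings of $L$ into $K^{sep}$, $\pi_L$ a uniformizer of $L$, and for $x>0$ let $\Gamma_x=\{\gamma\in\Gamma: v_L(\gamma(\pi_L)-\pi_L)\ge x+1\}$. A number $b>0$ is a lower ramification number if $\Gamma_b\ne\Gamma_{b+\epsilon}$ for all $\epsilon>0$, with multiplicity $m$ where $|\Gamma_b|/|\Gamma_{b+\epsilon}|=p^m$ for small $\epsilon>0$; listed with multiplicity they form $b_1\le\dots\le b_n$. The upper ramification numbers are defined by $u_1=b_1$ and $u_{i+1}=u_i+p^{ -i}(b_{i+1}-b_i)$ for $1\le i\le n-1$. -}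

module Defs where

open import Data.Nat as ℕ using (ℕ; zero; suc; _^_; NonZero)
open import Data.Nat.Properties using (m^n≢0)
open import Data.Integer using (+_)
open import Data.Rational using (ℚ; _/_; _+_; _*_; _-_)

pow : ℕ → ℕ → ℚ
pow p i = (+ (p ^ i)) / 1

invPow : (p : ℕ) → .{{NonZero p}} → ℕ → ℚ
invPow p i = (+ 1) / (p ^ i)
  where instance _ = m^n≢0 p i

-- Upper ramification numbers from lower ones (1-based indexing, index 0 unused):
--   u 1 = b 1,  u (i+1) = u i + p^(-i) (b (i+1) - b i)
upper : (p : ℕ) → .{{NonZero p}} → (ℕ → ℚ) → ℕ → ℚ
upper p b zero = b zero
upper p b (suc zero) = b 1
upper p b (suc (suc i)) = upper p b (suc i) + invPow p (suc i) * (b (suc (suc i)) - b (suc i))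

{-# OPTIONS --safe #-}
-- Part (a) is an induction on j: multiplying the recursion for u by p^j gives
--   p^j (u_{j+1} - u_i) = p^j (u_j - u_i) + (b_{j+1} - b_j),
-- and p^j (u_j - u_i) ≥ p^(j-1) (u_j - u_i) ≥ b_j - b_i because u is nondecreasing
-- along with b. Part (b) is part (a) for i = 1 plus u_1 = b_1 ≤ p^(j-1) b_1, where
-- the last inequality is strict once j ≥ 2, since p > 1 and b_1 > 0.
module Submission where

open import Defs
open import Data.Nat as ℕ using (ℕ; NonZero; zero; suc; z≤n; s≤s; _≤′_; ≤′-reflexive; ≤′-refl; ≤′-step)
import Data.Nat.Properties as ℕP
open import Data.Nat.Primality using (Prime; prime⇒nonTrivial)
open import Data.Integer as ℤ using (+_)
import Data.Integer.Properties as ℤP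
open import Data.Rational using (ℚ; _≤_; _<_; 0ℚ; 1ℚ; _*_; _-_; _+_; -_; _/_; toℚᵘ; NonNegative; nonNegative; positive)
import Data.Rational.Properties as ℚP
open import Data.Rational.Unnormalised as ℚᵘ using (mkℚᵘ; *≤*; *<*)
import Data.Rational.Unnormalised.Properties as ℚᵘP
open import Data.Rational.Solver using (module +-*-Solver)
open import Data.Product using (_×_; _,_)
open import Relation.Nullary using (contradiction)
open import Relation.Binary.PropositionalEquality using (_≡_; refl; cong; module ≡-Reasoning)

open +-*-Solver

-- i / suc n is by definition fromℚᵘ (mkℚᵘ i n).
toℚᵘ-/ : ∀ i n → toℚᵘ (i / suc n) ℚᵘ.≃ mkℚᵘ i n
toℚᵘ-/ i n = ℚP.toℚᵘ-fromℚᵘ (mkℚᵘ i n)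

m≤n⇒m/1≤n/1 : ∀ {m n} → m ℕ.≤ n → + m / 1 ≤ + n / 1
m≤n⇒m/1≤n/1 {m} {n} m≤n = ℚP.toℚᵘ-cancel-≤ (begin
  toℚᵘ (+ m / 1)  ≃⟨ toℚᵘ-/ (+ m) 0 ⟩
  mkℚᵘ (+ m) 0    ≤⟨ *≤* (ℤP.*-monoʳ-≤-nonNeg (+ 1) (ℤ.+≤+ m≤n)) ⟩
  mkℚᵘ (+ n) 0    ≃⟨ toℚᵘ-/ (+ n) 0 ⟨
  toℚᵘ (+ n / 1)  ∎)
  where open ℚᵘP.≤-Reasoning

m<n⇒m/1<n/1 : ∀ {m n} → m ℕ.< n → + m / 1 < + n / 1
m<n⇒m/1<n/1 {m} {n} m<n = ℚP.toℚᵘ-cancel-< (begin-strict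
  toℚᵘ (+ m / 1)  ≃⟨ toℚᵘ-/ (+ m) 0 ⟩
  mkℚᵘ (+ m) 0    <⟨ *<* (ℤP.*-monoʳ-<-pos (+ 1) (ℤ.+<+ m<n)) ⟩
  mkℚᵘ (+ n) 0    ≃⟨ toℚᵘ-/ (+ n) 0 ⟨
  toℚᵘ (+ n / 1)  ∎)
  where open ℚᵘP.≤-Reasoning

m/1*1/m≡1 : ∀ m .{{_ : NonZero m}} → (+ m / 1) * (+ 1 / m) ≡ 1ℚ
m/1*1/m≡1 m@(suc m-1) = ℚP.toℚᵘ-injective (begin-equality
  toℚᵘ ((+ m / 1) * (+ 1 / m))              ≃⟨ ℚP.toℚᵘ-homo-* (+ m / 1) (+ 1 / m) ⟩
  toℚᵘ (+ m / 1) ℚᵘ.* toℚᵘ (+ 1 / m)       ≃⟨ ℚᵘP.*-cong (toℚᵘ-/ (+ m) 0) (toℚᵘ-/ (+ 1) m-1) ⟩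
  mkℚᵘ (+ m) 0 ℚᵘ.* ℚᵘ.1/ mkℚᵘ (+ m) 0     ≃⟨ ℚᵘP.*-inverseʳ (mkℚᵘ (+ m) 0) ⟩
  toℚᵘ 1ℚ                                   ∎)
  where open ℚᵘP.≤-Reasoning

pow*invPow≡1 : ∀ p .{{_ : NonZero p}} k → pow p k * invPow p k ≡ 1ℚ
pow*invPow≡1 p k = m/1*1/m≡1 (p ℕ.^ k) {{ℕP.m^n≢0 p k}}

pow-mono-≤ : ∀ p .{{_ : NonZero p}} {k l} → k ℕ.≤ l → pow p k ≤ pow p l
pow-mono-≤ p k≤l = m≤n⇒m/1≤n/1 (ℕP.^-monoʳ-≤ p k≤l)

pow-mono-< : ∀ {p} → 1 ℕ.< p → ∀ {k l} → k ℕ.< l → pow p k < pow p l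
pow-mono-< {p} 1<p k<l = m<n⇒m/1<n/1 (ℕP.^-monoʳ-< p 1<p k<l)

1≤pow : ∀ p .{{_ : NonZero p}} k → 1ℚ ≤ pow p k
1≤pow p k = pow-mono-≤ p {l = k} z≤n

1<pow : ∀ {p} → 1 ℕ.< p → ∀ {k} → 0 ℕ.< k → 1ℚ < pow p k
1<pow 1<p {k} 0<k = pow-mono-< 1<p {l = k} 0<k

invPow-nonNeg : ∀ p .{{_ : NonZero p}} k → NonNegative (invPow p k)
invPow-nonNeg p k = ℚP.normalize-nonNeg 1 (p ℕ.^ k) {{ℕP.m^n≢0 p k}}

p≤q⇒0≤q-p : ∀ {p q} → p ≤ q → 0ℚ ≤ q - p
p≤q⇒0≤q-p {p} {q} p≤q = begin
  0ℚ     ≡⟨ ℚP.+-inverseʳ p ⟨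
  p - p  ≤⟨ ℚP.+-monoˡ-≤ (- p) p≤q ⟩
  q - p  ∎
  where open ℚP.≤-Reasoning

x≤q*x : ∀ {q x} → 1ℚ ≤ q → 0ℚ ≤ x → x ≤ q * x
x≤q*x {q} {x} 1≤q 0≤x = begin
  x       ≡⟨ ℚP.*-identityˡ x ⟨
  1ℚ * x  ≤⟨ ℚP.*-monoʳ-≤-nonNeg x {{nonNegative 0≤x}} 1≤q ⟩
  q * x   ∎
  where open ℚP.≤-Reasoning

x<q*x : ∀ {q x} → 1ℚ < q → 0ℚ < x → x < q * x
x<q*x {q} {x} 1<q 0<x = begin-strict
  x       ≡⟨ ℚP.*-identityˡ x ⟨
  1ℚ * x  <⟨ ℚP.*-monoˡ-<-pos x {{positive 0<x}} 1<q ⟩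
  q * x   ∎
  where open ℚP.≤-Reasoning

NondecreasingOn : ℕ → (ℕ → ℚ) → Set
NondecreasingOn n b = ∀ i j → 1 ℕ.≤ i → i ℕ.≤ j → j ℕ.≤ n → b i ≤ b j

module Ramification (p : ℕ) .{{_ : NonZero p}} (b : ℕ → ℚ) where

  u : ℕ → ℚ
  u = upper p b

  upper-step : ∀ k x → pow p (suc k) * (u (suc (suc k)) - x)
                     ≡ pow p (suc k) * (u (suc k) - x) + (b (suc (suc k)) - b (suc k))
  upper-step k x = begin
    q * ((u (suc k) + r * d) - x)
      ≡⟨ solve 5 (λ q r y d x → q :* ((y :+ r :* d) :- x) := q :* (y :- x) :+ (q :* r) :* d)
               refl q r (u (suc k)) d x ⟩
    q * (u (suc k) - x) + (q * r) * d
      ≡⟨ cong (λ c → q * (u (suc k) - x) + c * d) (pow*invPow≡1 p (suc k)) ⟩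
    q * (u (suc k) - x) + 1ℚ * d
      ≡⟨ cong (_+_ (q * (u (suc k) - x))) (ℚP.*-identityˡ d) ⟩
    q * (u (suc k) - x) + d
      ∎
    where
    open ≡-Reasoning
    q = pow p (suc k)
    r = invPow p (suc k)
    d = b (suc (suc k)) - b (suc k)

  upper-suc-mono : ∀ k → b (suc k) ≤ b (suc (suc k)) → u (suc k) ≤ u (suc (suc k))
  upper-suc-mono k bₖ≤bₖ₊₁ = begin
    u (suc k)          ≡⟨ ℚP.+-identityʳ (u (suc k)) ⟨
    u (suc k) + 0ℚ     ≤⟨ ℚP.+-monoʳ-≤ (u (suc k)) (ℚP.nonNegative⁻¹ (r * d) {{ℚP.nonNeg*nonNeg⇒nonNeg r d}}) ⟩
    u (suc k) + r * d  ∎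
    where
    open ℚP.≤-Reasoning
    r = invPow p (suc k)
    d = b (suc (suc k)) - b (suc k)
    instance
      _ : NonNegative r
      _ = invPow-nonNeg p (suc k)
      _ : NonNegative d
      _ = nonNegative (p≤q⇒0≤q-p bₖ≤bₖ₊₁)

  module Nondecreasing (n : ℕ) (mono : NondecreasingOn n b) where

    upper-mono : ∀ {i j} → 1 ℕ.≤ i → i ≤′ j → j ℕ.≤ n → u i ≤ u j
    upper-mono _ ≤′-refl _ = ℚP.≤-refl
    upper-mono (s≤s z≤n) (≤′-step {zero} (≤′-reflexive ())) _
    upper-mono 1≤i (≤′-step {suc k} i≤′k+1) k+2≤n =
      ℚP.≤-trans (upper-mono 1≤i i≤′k+1 (ℕP.<⇒≤ k+2≤n))
                 (upper-suc-mono k (mono (suc k) (suc (suc k)) (s≤s z≤n) (ℕP.n≤1+n (suc k)) k+2≤n))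

    lower-gap≤pow*upper-gap : ∀ {i j} → 1 ℕ.≤ i → i ≤′ j → j ℕ.≤ n
                            → b j - b i ≤ pow p (ℕ.pred j) * (u j - u i)
    lower-gap≤pow*upper-gap {i} {j} _ ≤′-refl _ =
      ℚP.≤-reflexive (solve 3 (λ q x y → x :- x := q :* (y :- y)) refl (pow p (ℕ.pred j)) (b i) (u i))
    lower-gap≤pow*upper-gap (s≤s z≤n) (≤′-step {zero} (≤′-reflexive ())) _
    lower-gap≤pow*upper-gap {i} 1≤i (≤′-step {suc k} i≤′k+1) k+2≤n = begin
      b j - b i
        ≡⟨ solve 3 (λ x y z → z :- x := (y :- x) :+ (z :- y)) refl (b i) (b j') (b j) ⟩
      (b j' - b i) + (b j - b j')
        ≤⟨ ℚP.+-monoˡ-≤ (b j - b j') (lower-gap≤pow*upper-gap 1≤i i≤′k+1 k+1≤n) ⟩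
      pow p k * (u j' - u i) + (b j - b j')
        ≤⟨ ℚP.+-monoˡ-≤ (b j - b j') (ℚP.*-monoʳ-≤-nonNeg (u j' - u i) (pow-mono-≤ p (ℕP.n≤1+n k))) ⟩
      pow p j' * (u j' - u i) + (b j - b j')
        ≡⟨ upper-step k (u i) ⟨
      pow p j' * (u j - u i)
        ∎
      where
      open ℚP.≤-Reasoning
      j' = suc k
      j = suc j'
      k+1≤n = ℕP.<⇒≤ k+2≤n
      instance
        _ : NonNegative (u j' - u i)
        _ = nonNegative (p≤q⇒0≤q-p (upper-mono 1≤i i≤′k+1 k+1≤n))

    private
      lower≡gap+b₁ : ∀ j → b j ≡ (b j - b 1) + b 1
      lower≡gap+b₁ j = solve 2 (λ x y → x := (x :- y) :+ y) refl (b j) (b 1)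

      scaled-upper≡gap+b₁ : ∀ q j → q * u j ≡ q * (u j - u 1) + q * b 1
      scaled-upper≡gap+b₁ q j = solve 3 (λ q x y → q :* x := q :* (x :- y) :+ q :* y) refl q (u j) (b 1)

    lower≤pow*upper : 0ℚ ≤ b 1 → ∀ {j} → 1 ℕ.≤ j → j ℕ.≤ n → b j ≤ pow p (ℕ.pred j) * u j
    lower≤pow*upper 0≤b₁ {j} 1≤j j≤n = begin
      b j                        ≡⟨ lower≡gap+b₁ j ⟩
      (b j - b 1) + b 1          ≤⟨ ℚP.+-mono-≤ (lower-gap≤pow*upper-gap ℕP.≤-refl (ℕP.≤⇒≤′ 1≤j) j≤n)
                                                (x≤q*x (1≤pow p (ℕ.pred j)) 0≤b₁) ⟩
      q * (u j - u 1) + q * b 1  ≡⟨ scaled-upper≡gap+b₁ q j ⟨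
      q * u j                    ∎
      where
      open ℚP.≤-Reasoning
      q = pow p (ℕ.pred j)

    lower<pow*upper : 1 ℕ.< p → 0ℚ < b 1 → ∀ {j} → 2 ℕ.≤ j → j ℕ.≤ n → b j < pow p (ℕ.pred j) * u j
    lower<pow*upper 1<p 0<b₁ {j} 2≤j j≤n = begin-strict
      b j                        ≡⟨ lower≡gap+b₁ j ⟩
      (b j - b 1) + b 1          <⟨ ℚP.+-mono-≤-< (lower-gap≤pow*upper-gap ℕP.≤-refl (ℕP.≤⇒≤′ 1≤j) j≤n)
                                                  (x<q*x (1<pow 1<p (ℕP.pred-mono-≤ 2≤j)) 0<b₁) ⟩
      q * (u j - u 1) + q * b 1  ≡⟨ scaled-upper≡gap+b₁ q j ⟨
      q * u j                    ∎
      where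
      open ℚP.≤-Reasoning
      q = pow p (ℕ.pred j)
      1≤j = ℕP.<⇒≤ 2≤j

    lower≡pow*upper⇒≡1 : 1 ℕ.< p → 0ℚ < b 1 → ∀ {j} → 1 ℕ.≤ j → j ℕ.≤ n
                       → b j ≡ pow p (ℕ.pred j) * u j → j ≡ 1
    lower≡pow*upper⇒≡1 _ _ {suc zero} _ _ _ = refl
    lower≡pow*upper⇒≡1 1<p 0<b₁ {suc (suc _)} _ j≤n eq =
      contradiction eq (ℚP.<⇒≢ (lower<pow*upper 1<p 0<b₁ (s≤s (s≤s z≤n)) j≤n))

corollary2p5 : (p : ℕ) → .{{_ : NonZero p}} → Prime p → (n : ℕ) → (b : ℕ → ℚ)
    → (∀ i → 1 ℕ.≤ i → i ℕ.≤ n → 0ℚ < b i)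
    → (∀ i j → 1 ℕ.≤ i → i ℕ.≤ j → j ℕ.≤ n → b i ≤ b j)
    → ((∀ i j → 1 ℕ.≤ i → i ℕ.≤ j → j ℕ.≤ n
          → b j - b i ≤ pow p (ℕ.pred j) * (upper p b j - upper p b i))
      × (∀ j → 1 ℕ.≤ j → j ℕ.≤ n
          → (b j ≤ pow p (ℕ.pred j) * upper p b j)
            × (b j ≡ pow p (ℕ.pred j) * upper p b j → j ≡ 1)))
corollary2p5 p pr n b pos mono =
    (λ i j 1≤i i≤j j≤n → lower-gap≤pow*upper-gap 1≤i (ℕP.≤⇒≤′ i≤j) j≤n)
  , λ j 1≤j j≤n →
      let 0<b₁ = pos 1 ℕP.≤-refl (ℕP.≤-trans 1≤j j≤n) in
      lower≤pow*upper (ℚP.<⇒≤ 0<b₁) 1≤j j≤n , lower≡pow*upper⇒≡1 1<p 0<b₁ 1≤j j≤n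
  where
  open Ramification p b
  open Nondecreasing n mono
  1<p : 1 ℕ.< p
  1<p = ℕ.nonTrivial⇒n>1 p {{prime⇒nonTrivial pr}}
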